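{- Let $d,k$ be positive integers and $r$ a positive real number. Let $L_d(r)=\{v\in\mathbb{Z}^d\colon \|v\|_2\leq r,\ v_i>0\text{ for } 1\leq i\leq d\}$ and $L_{d,k}(r)=\{v\in\mathbb{Z}^d\colon \|v\|_2\leq r,\ v_i>0 \text{ and } k\nmid v_i \text{ for } 1\leq i\leq d\}$. Then $k^d|L_{d,k}(r)|\geq(k-1)^d|L_d(r)|$. -}

module Defs where

open import Data.Nat using (ℕ; zero; suc; _*_; _≤_; _<_; _≤?_; _<?_)
open import Data.Nat.Divisibility using (_∣_; _∣?_)
open import Data.List using (List; []; _∷_; [_]; map; concatMap; upTo; filter; length)
open import Data.Vec using (Vec; []; _∷_; sum)
import Data.Vec as Vec
open import Data.Vec.Relation.Unary.All using (All; all?)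
open import Data.Product using (_×_)
open import Relation.Nullary using (¬_; ¬?; Dec)
open import Relation.Nullary.Decidable using (_×-dec_)

sqNorm : ∀ {d} → Vec ℕ d → ℕ
sqNorm v = sum (Vec.map (λ x → x * x) v)

box : (d B : ℕ) → List (Vec ℕ d)
box zero    B = [ [] ]
box (suc d) B = concatMap (λ x → map (x ∷_) (box d B)) (upTo (suc B))

-- v ∈ L_d(r), with R = ⌊r²⌋ :  ‖v‖₂² ≤ R and all v_i > 0.
InL : ∀ {d} → ℕ → Vec ℕ d → Set
InL R v = sqNorm v ≤ R × All (0 <_) v

InLk : ∀ {d} → ℕ → ℕ → Vec ℕ d → Set
InLk k R v = sqNorm v ≤ R × All (λ x → 0 < x × ¬ (k ∣ x)) v

InL? : ∀ {d} (R : ℕ) (v : Vec ℕ d) → Dec (InL R v)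
InL? R v = (sqNorm v ≤? R) ×-dec all? (λ x → 0 <? x) v

InLk? : ∀ {d} (k R : ℕ) (v : Vec ℕ d) → Dec (InLk k R v)
InLk? k R v = (sqNorm v ≤? R) ×-dec all? (λ x → (0 <? x) ×-dec ¬? (k ∣? x)) v

-- |L_d(r)|.  Every v ∈ L_d(r) has v_i ≤ v_i² ≤ R, so it lies in box d R.
cardL : (d R : ℕ) → ℕ
cardL d R = length (filter (InL? R) (box d R))

cardLk : (d k R : ℕ) → ℕ
cardLk d k R = length (filter (InLk? k R) (box d R))

module Submission where

-- Write R = ⌊r²⌋; both lattice sets lie in the box {0,…,R}^d.  The proof is an
-- induction on the dimension d, peeling off the first coordinate x of a lattice
-- point.  To make the induction go through, ballCount counts, for an offset a,
-- the points v of the box {0,…,B}^d with a + ‖v‖² ≤ R all of whose coordinates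
-- satisfy a decidable predicate Q.  Splitting on the first coordinate writes the
-- count in dimension d+1 as a sum over x of the counts in dimension d with
-- offset a + x², restricted to those x with Q x; as a function of x these
-- counts are nonincreasing.
--
-- Hence the whole theorem reduces to a one-dimensional comparison of weighted
-- sums ("domination"): if n·Σ_{P x} g x ≤ k·Σ_{Q x} g x for every nonincreasing
-- g, then n^d·#(P-points) ≤ k^d·#(Q-points) in every dimension d.
-- For P = "positive" and Q = "positive and not divisible by k", the
-- one-dimensional inequality (k-1)·Σ_{1≤x≤m} g x ≤ k·Σ_{1≤x≤m, k∤x} g x is
-- proved by tracking the defect (m mod k)·g m along m.

open import Defs
open import Data.Nat using (ℕ; zero; suc; _+_; _*_; _^_; _∸_; _≤_; _<_; z≤n; s≤s)
open import Data.Nat.Properties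
open import Data.Nat.DivMod using (_%_; %-distribˡ-+; m%n%n≡m%n; m%n<n; m<n⇒m%n≡m; n%n≡0; %-pred-≡0)
open import Data.Nat.Divisibility using (_∣_; _∣?_; m%n≡0⇒n∣m; n∣m⇒m%n≡0)
open import Data.Nat.Solver using (module +-*-Solver)
open import Data.Bool using (true; false; if_then_else_)
open import Data.List using (List; []; _∷_; [_]; _++_; _∷ʳ_; map; concatMap; upTo; filter; length)
open import Data.Nat.ListAction using (sum)
open import Data.Nat.ListAction.Properties using (sum-++)
open import Data.List.Properties using (upTo-∷ʳ; map-++; map-cong; filter-++; length-++; filter-≐; filter-none)
open import Data.List.Relation.Unary.All as ListAll using ()
open import Data.List.Relation.Binary.Sublist.Propositional using (⊆-refl)
open import Data.List.Relation.Binary.Sublist.Propositional.Properties using (filter⁺)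
open import Data.List.Relation.Binary.Sublist.Heterogeneous.Properties using (length-mono-≤)
open import Data.Vec using (Vec; _∷_)
open import Data.Vec.Relation.Unary.All using (All; all?; []; _∷_)
open import Data.Product using (_×_; _,_)
open import Data.Sum using (_⊎_; inj₁; inj₂)
open import Level using (0ℓ)
open import Relation.Nullary using (¬_; ¬?; does; yes; no; contradiction)
open import Relation.Nullary.Decidable using (_×-dec_)
open import Relation.Unary using (Pred; Decidable)
open import Relation.Binary.PropositionalEquality using (_≡_; _≢_; refl; sym; trans; cong; cong₂; subst; module ≡-Reasoning)

module _ {A : Set} where

  count-mono : {P Q : Pred A 0ℓ} (P? : Decidable P) (Q? : Decidable Q) →
    (∀ {x} → P x → Q x) → ∀ xs → length (filter P? xs) ≤ length (filter Q? xs)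
  count-mono P? Q? P⇒Q xs = length-mono-≤ (filter⁺ P? Q? (λ { refl → P⇒Q }) (⊆-refl {x = xs}))

  count-map : {B : Set} {P : Pred A 0ℓ} (P? : Decidable P) (f : B → A) → ∀ xs →
    length (filter P? (map f xs)) ≡ length (filter (λ x → P? (f x)) xs)
  count-map P? f [] = refl
  count-map P? f (x ∷ xs) with does (P? (f x))
  ... | true  = cong suc (count-map P? f xs)
  ... | false = count-map P? f xs

  count-concatMap : {B : Set} {P : Pred A 0ℓ} (P? : Decidable P) (f : B → List A) → ∀ xs →
    length (filter P? (concatMap f xs)) ≡ sum (map (λ x → length (filter P? (f x))) xs)
  count-concatMap P? f [] = refl
  count-concatMap P? f (x ∷ xs) = begin
    length (filter P? (f x ++ concatMap f xs))
      ≡⟨ cong length (filter-++ P? (f x) (concatMap f xs)) ⟩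
    length (filter P? (f x) ++ filter P? (concatMap f xs))
      ≡⟨ length-++ (filter P? (f x)) ⟩
    length (filter P? (f x)) + length (filter P? (concatMap f xs))
      ≡⟨ cong (length (filter P? (f x)) +_) (count-concatMap P? f xs) ⟩
    length (filter P? (f x)) + sum (map (λ y → length (filter P? (f y))) xs) ∎
    where open ≡-Reasoning

Σ< : (ℕ → ℕ) → ℕ → ℕ
Σ< f zero    = 0
Σ< f (suc m) = Σ< f m + f m

sum-upTo : ∀ f m → sum (map f (upTo m)) ≡ Σ< f m
sum-upTo f zero    = refl
sum-upTo f (suc m) = begin
  sum (map f (upTo (suc m)))          ≡⟨ cong (λ xs → sum (map f xs)) (sym (upTo-∷ʳ m)) ⟩
  sum (map f (upTo m ∷ʳ m))           ≡⟨ cong sum (map-++ f (upTo m) [ m ]) ⟩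
  sum (map f (upTo m) ++ [ f m ])     ≡⟨ sum-++ (map f (upTo m)) [ f m ] ⟩
  sum (map f (upTo m)) + (f m + 0)    ≡⟨ cong₂ _+_ (sum-upTo f m) (+-identityʳ (f m)) ⟩
  Σ< f m + f m                        ∎
  where open ≡-Reasoning

Σ<-cong : ∀ {f g} → (∀ x → f x ≡ g x) → ∀ m → Σ< f m ≡ Σ< g m
Σ<-cong f≡g zero    = refl
Σ<-cong f≡g (suc m) = cong₂ _+_ (Σ<-cong f≡g m) (f≡g m)

Σ<-mono : ∀ {f g} → (∀ x → f x ≤ g x) → ∀ m → Σ< f m ≤ Σ< g m
Σ<-mono f≤g zero    = z≤n
Σ<-mono f≤g (suc m) = +-mono-≤ (Σ<-mono f≤g m) (f≤g m)

Σ<-scale : ∀ c f m → c * Σ< f m ≡ Σ< (λ x → c * f x) m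
Σ<-scale c f zero    = *-zeroʳ c
Σ<-scale c f (suc m) = trans (*-distribˡ-+ c (Σ< f m) (f m)) (cong (_+ c * f m) (Σ<-scale c f m))

restrict : {Q : Pred ℕ 0ℓ} → Decidable Q → (ℕ → ℕ) → ℕ → ℕ
restrict Q? g x = if does (Q? x) then g x else 0

module _ {Q : Pred ℕ 0ℓ} (Q? : Decidable Q) where

  restrict-yes : ∀ g {x} → Q x → restrict Q? g x ≡ g x
  restrict-yes g {x} q with Q? x
  ... | yes _ = refl
  ... | no ¬q = contradiction q ¬q

  restrict-no : ∀ g {x} → ¬ Q x → restrict Q? g x ≡ 0
  restrict-no g {x} ¬q with Q? x
  ... | yes q = contradiction q ¬q
  ... | no _  = refl

  restrict-mono : ∀ {f g} → (∀ x → f x ≤ g x) → ∀ x → restrict Q? f x ≤ restrict Q? g x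
  restrict-mono f≤g x with does (Q? x)
  ... | true  = f≤g x
  ... | false = z≤n

  restrict-scale : ∀ c g x → c * restrict Q? g x ≡ restrict Q? (λ y → c * g y) x
  restrict-scale c g x with does (Q? x)
  ... | true  = refl
  ... | false = *-zeroʳ c

  Σ-restrict-mono : ∀ {f g} → (∀ x → f x ≤ g x) → ∀ m → Σ< (restrict Q? f) m ≤ Σ< (restrict Q? g) m
  Σ-restrict-mono f≤g = Σ<-mono (restrict-mono f≤g)

  Σ-restrict-scale : ∀ c g m → c * Σ< (restrict Q? g) m ≡ Σ< (restrict Q? (λ y → c * g y)) m
  Σ-restrict-scale c g m = trans (Σ<-scale c (restrict Q? g) m) (Σ<-cong (restrict-scale c g) m)

remainder-step : ∀ n m →
  (suc n ∣ suc m × m % suc n ≡ n) ⊎ (¬ suc n ∣ suc m × suc m % suc n ≡ suc (m % suc n))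
remainder-step n m with suc n ∣? suc m
... | yes k∣m+1 = inj₁ (k∣m+1 , %-pred-≡0 (n∣m⇒m%n≡0 (suc m) (suc n) k∣m+1))
... | no  k∤m+1 = inj₂ (k∤m+1 , trans suc-% (m<n⇒m%n≡m r+1<k))
  where
  k = suc n

  suc-% : suc m % k ≡ suc (m % k) % k
  suc-% = begin
    (1 + m) % k                 ≡⟨ %-distribˡ-+ 1 m k ⟩
    (1 % k + m % k) % k         ≡⟨ cong (λ r → (1 % k + r) % k) (sym (m%n%n≡m%n m k)) ⟩
    (1 % k + m % k % k) % k     ≡⟨ sym (%-distribˡ-+ 1 (m % k) k) ⟩
    (1 + m % k) % k             ∎
    where open ≡-Reasoning

  r+1≢k : suc (m % k) ≢ k
  r+1≢k r+1≡k = k∤m+1 (m%n≡0⇒n∣m (suc m) k (trans suc-% (trans (cong (_% k) r+1≡k) (n%n≡0 k))))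

  r+1<k : suc (m % k) < k
  r+1<k = ≤∧≢⇒< (m%n<n m k) r+1≢k

positive? : Decidable (0 <_)
positive? x = 0 <? x

nonMultiple? : (k : ℕ) → Decidable (λ x → 0 < x × ¬ k ∣ x)
nonMultiple? k x = (0 <? x) ×-dec ¬? (k ∣? x)

-- The weights x ↦ #(points with first coordinate x) are of this kind.
Nonincreasing : (ℕ → ℕ) → Set
Nonincreasing g = ∀ m → g (suc m) ≤ g m

-- With k = n+1, the one-dimensional inequality carries a defect (m mod k)·g m:
--   n·Σ_{1≤x≤m} g x + (m mod k)·g m  ≤  k·Σ_{1≤x≤m, k∤x} g x.
-- A step m ↦ m+1 with k ∤ m+1 adds k·g(m+1) on the right, which pays for
-- n·g(m+1) and the growth of the defect; when k ∣ m+1 the defect n·g m ≥ n·g(m+1)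
-- accumulated over the last block pays for the new term and is reset to 0.
thinning-invariant : ∀ n g → Nonincreasing g → ∀ m →
  n * Σ< (restrict positive? g) (suc m) + (m % suc n) * g m
    ≤ suc n * Σ< (restrict (nonMultiple? (suc n)) g) (suc m)
thinning-invariant n g g↓ zero =
  ≤-reflexive (trans (+-identityʳ (n * 0)) (trans (*-zeroʳ n) (sym (*-zeroʳ (suc n)))))
thinning-invariant n g g↓ (suc m) with remainder-step n m
... | inj₁ (k∣m+1 , r≡n) = begin
  n * (a + restrict positive? g (suc m)) + (suc m % k) * h
    ≡⟨ cong₂ (λ t s → n * (a + t) + s * h) (restrict-yes positive? g (s≤s z≤n)) (n∣m⇒m%n≡0 (suc m) k k∣m+1) ⟩
  n * (a + h) + 0
    ≡⟨ trans (+-identityʳ (n * (a + h))) (*-distribˡ-+ n a h) ⟩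
  n * a + n * h
    ≤⟨ +-monoʳ-≤ (n * a) (*-monoʳ-≤ n (g↓ m)) ⟩
  n * a + n * g m
    ≡⟨ cong (λ r → n * a + r * g m) (sym r≡n) ⟩
  n * a + (m % k) * g m
    ≤⟨ thinning-invariant n g g↓ m ⟩
  k * b
    ≡⟨ cong (k *_) (sym (trans (cong (b +_) (restrict-no (nonMultiple? k) g (λ (_ , k∤) → k∤ k∣m+1))) (+-identityʳ b))) ⟩
  k * (b + restrict (nonMultiple? k) g (suc m)) ∎
  where
  open ≤-Reasoning
  k = suc n ; a = Σ< (restrict positive? g) (suc m) ; b = Σ< (restrict (nonMultiple? k) g) (suc m) ; h = g (suc m)
... | inj₂ (k∤m+1 , r+1≡r') = begin
  n * (a + restrict positive? g (suc m)) + (suc m % k) * h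
    ≡⟨ cong₂ (λ t s → n * (a + t) + s * h) (restrict-yes positive? g (s≤s z≤n)) r+1≡r' ⟩
  n * (a + h) + suc r * h
    ≡⟨ regroup n a h r ⟩
  (n * a + r * h) + k * h
    ≤⟨ +-monoˡ-≤ (k * h) (+-monoʳ-≤ (n * a) (*-monoʳ-≤ r (g↓ m))) ⟩
  (n * a + r * g m) + k * h
    ≤⟨ +-monoˡ-≤ (k * h) (thinning-invariant n g g↓ m) ⟩
  k * b + k * h
    ≡⟨ sym (*-distribˡ-+ k b h) ⟩
  k * (b + h)
    ≡⟨ cong (λ t → k * (b + t)) (sym (restrict-yes (nonMultiple? k) g (s≤s z≤n , k∤m+1))) ⟩
  k * (b + restrict (nonMultiple? k) g (suc m)) ∎
  where
  open ≤-Reasoning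
  k = suc n ; a = Σ< (restrict positive? g) (suc m) ; b = Σ< (restrict (nonMultiple? k) g) (suc m)
  h = g (suc m) ; r = m % k
  regroup : ∀ n a h r → n * (a + h) + suc r * h ≡ (n * a + r * h) + suc n * h
  regroup = solve 4 (λ n a h r → n :* (a :+ h) :+ (con 1 :+ r) :* h := (n :* a :+ r :* h) :+ (con 1 :+ n) :* h) refl
    where open +-*-Solver

Dominates : {P Q : Pred ℕ 0ℓ} → ℕ → Decidable P → ℕ → Decidable Q → Set
Dominates n P? k Q? =
  ∀ g → Nonincreasing g → ∀ m → n * Σ< (restrict P? g) m ≤ k * Σ< (restrict Q? g) m

thinning : ∀ n → Dominates n positive? (suc n) (nonMultiple? (suc n))
thinning n g g↓ zero    = ≤-reflexive (trans (*-zeroʳ n) (sym (*-zeroʳ (suc n))))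
thinning n g g↓ (suc m) = ≤-trans (m≤m+n _ _) (thinning-invariant n g g↓ m)

InBall? : {Q : Pred ℕ 0ℓ} → Decidable Q → (R a : ℕ) → ∀ {d} →
  Decidable (λ (v : Vec ℕ d) → a + sqNorm v ≤ R × All Q v)
InBall? Q? R a v = (a + sqNorm v ≤? R) ×-dec all? Q? v

-- The number of such v in the box {0,…,B}^d.  For a = 0 and B = R this is
-- |L_d(r)| resp. |L_{d,k}(r)| (definitionally).
ballCount : {Q : Pred ℕ 0ℓ} → Decidable Q → (R B d a : ℕ) → ℕ
ballCount Q? R B d a = length (filter (InBall? Q? R a) (box d B))

module _ {Q : Pred ℕ 0ℓ} (Q? : Decidable Q) (R B : ℕ) where

  ballCount-antitone : ∀ d {a a′} → a ≤ a′ → ballCount Q? R B d a′ ≤ ballCount Q? R B d a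
  ballCount-antitone d a≤a′ = count-mono (InBall? Q? R _) (InBall? Q? R _)
    (λ (inside , coords) → ≤-trans (+-monoˡ-≤ _ a≤a′) inside , coords) (box d B)

  count-fibre : ∀ d a x →
    length (filter (InBall? Q? R a) (map (x ∷_) (box d B)))
      ≡ restrict Q? (λ y → ballCount Q? R B d (a + y * y)) x
  count-fibre d a x with Q? x
  ... | yes q = begin
    length (filter (InBall? Q? R a) (map (x ∷_) (box d B)))    ≡⟨ count-map (InBall? Q? R a) (x ∷_) (box d B) ⟩
    length (filter (λ v → InBall? Q? R a (x ∷ v)) (box d B))    ≡⟨ cong length (filter-≐ _ (InBall? Q? R (a + x * x)) (shift , unshift) (box d B)) ⟩
    ballCount Q? R B d (a + x * x)                              ∎
    where
    open ≡-Reasoning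
    shift : ∀ {v} → a + (x * x + sqNorm v) ≤ R × All Q (x ∷ v) → a + x * x + sqNorm v ≤ R × All Q v
    shift {v} (inside , _ ∷ coords) = subst (_≤ R) (sym (+-assoc a (x * x) (sqNorm v))) inside , coords
    unshift : ∀ {v} → a + x * x + sqNorm v ≤ R × All Q v → a + (x * x + sqNorm v) ≤ R × All Q (x ∷ v)
    unshift {v} (inside , coords) = subst (_≤ R) (+-assoc a (x * x) (sqNorm v)) inside , q ∷ coords
  ... | no ¬q = begin
    length (filter (InBall? Q? R a) (map (x ∷_) (box d B)))    ≡⟨ count-map (InBall? Q? R a) (x ∷_) (box d B) ⟩
    length (filter (λ v → InBall? Q? R a (x ∷ v)) (box d B))    ≡⟨ cong length (filter-none _ (ListAll.universal (λ { _ (_ , q ∷ _) → ¬q q }) (box d B))) ⟩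
    0                                                           ∎
    where open ≡-Reasoning

  ballCount-suc : ∀ d a →
    ballCount Q? R B (suc d) a ≡ Σ< (restrict Q? (λ x → ballCount Q? R B d (a + x * x))) (suc B)
  ballCount-suc d a = begin
    ballCount Q? R B (suc d) a
      ≡⟨ count-concatMap (InBall? Q? R a) (λ x → map (x ∷_) (box d B)) (upTo (suc B)) ⟩
    sum (map (λ x → length (filter (InBall? Q? R a) (map (x ∷_) (box d B)))) (upTo (suc B)))
      ≡⟨ cong sum (map-cong (count-fibre d a) (upTo (suc B))) ⟩
    sum (map (restrict Q? (λ x → ballCount Q? R B d (a + x * x))) (upTo (suc B)))
      ≡⟨ sum-upTo _ (suc B) ⟩
    Σ< (restrict Q? (λ x → ballCount Q? R B d (a + x * x))) (suc B) ∎
    where open ≡-Reasoning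

-- Domination in dimension one lifts to every dimension: induct on d, split off
-- the first coordinate and apply the hypothesis to the nonincreasing function
-- x ↦ k^d · ballCount Q (a + x²).
compare-counts : {P Q : Pred ℕ 0ℓ} {P? : Decidable P} {Q? : Decidable Q} {n k : ℕ} →
  Dominates n P? k Q? → ∀ R B d a → n ^ d * ballCount P? R B d a ≤ k ^ d * ballCount Q? R B d a
compare-counts {P? = P?} {Q?} dom R B zero a =
  +-monoˡ-≤ 0 (count-mono (InBall? P? R a) (InBall? Q? R a) (λ { (inside , []) → inside , [] }) (box 0 B))
compare-counts {P? = P?} {Q?} {n} {k} dom R B (suc d) a = begin
  n * n ^ d * ballCount P? R B (suc d) a          ≡⟨ *-assoc n (n ^ d) _ ⟩
  n * (n ^ d * ballCount P? R B (suc d) a)        ≡⟨ cong (λ c → n * (n ^ d * c)) (ballCount-suc P? R B d a) ⟩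
  n * (n ^ d * Σ< (restrict P? fibreP) (suc B))   ≡⟨ cong (n *_) (Σ-restrict-scale P? (n ^ d) fibreP (suc B)) ⟩
  n * Σ< (restrict P? (λ x → n ^ d * fibreP x)) (suc B)
    ≤⟨ *-monoʳ-≤ n (Σ-restrict-mono P? (λ x → compare-counts dom R B d (a + x * x)) (suc B)) ⟩
  n * Σ< (restrict P? g) (suc B)                  ≤⟨ dom g g↓ (suc B) ⟩
  k * Σ< (restrict Q? g) (suc B)                  ≡⟨ cong (k *_) (Σ-restrict-scale Q? (k ^ d) fibreQ (suc B)) ⟨
  k * (k ^ d * Σ< (restrict Q? fibreQ) (suc B))   ≡⟨ cong (λ c → k * (k ^ d * c)) (ballCount-suc Q? R B d a) ⟨
  k * (k ^ d * ballCount Q? R B (suc d) a)        ≡⟨ *-assoc k (k ^ d) _ ⟨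
  k * k ^ d * ballCount Q? R B (suc d) a          ∎
  where
  open ≤-Reasoning
  fibreP fibreQ g : ℕ → ℕ
  fibreP x = ballCount P? R B d (a + x * x)
  fibreQ x = ballCount Q? R B d (a + x * x)
  g x = k ^ d * fibreQ x
  g↓ : Nonincreasing g
  g↓ x = *-monoʳ-≤ (k ^ d) (ballCount-antitone Q? R B d (+-monoʳ-≤ a (*-mono-≤ (n≤1+n x) (n≤1+n x))))

lemma2p5 : (d k R : ℕ) → 1 ≤ d → 1 ≤ k →
    (k ∸ 1) ^ d * cardL d R ≤ k ^ d * cardLk d k R
lemma2p5 d zero    R _ ()
lemma2p5 d (suc n) R _ _ = compare-counts (thinning n) R R d 0
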